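{- Let $(\chi,f,g)$ be an oriented matroid program of rank $r$, let $L=\{\lambda_1,\ldots,\lambda_{r-2}\}\subset E-\{f,g\}$ and $a,b\in E-\{f,g\}$ be such that $L\cup\{a\}=B_1\to B_2=L\cup\{b\}$ is a pivot operation along the edge $L$. Then: (i) if $B_1\to B_2$ is strictly increasing, then $\chi(\lambda_1,\ldots,\lambda_{r-2},g,f)\cdot\chi(\lambda_1,\ldots,\lambda_{r-2},a,b)\cdot\chi(\lambda_1,\ldots,\lambda_{r-2},g,a)\cdot\chi(\lambda_1,\ldots,\lambda_{r-2},g,b)=+1$; (ii) if $B_1\to B_2$ is degenerate or horizontal, then $\chi(\lambda_1,\ldots,\lambda_{r-2},g,f)\cdot\chi(\lambda_1,\ldots,\lambda_{r-2},a,b)\cdot\chi(\lambda_1,\ldots,\lambda_{r-2},g,a)\cdot\chi(\lambda_1,\ldots,\lambda_{r-2},g,b)=0$.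
   Context: An oriented matroid program (OMP) $(\chi,f,g)$ is an oriented matroid $\chi$ (chirotope) of rank $r$ on a ground set $E=\{1,\ldots,n,f,g\}$ with two distinguished elements $f,g$. Let ${\mathcal A}$ (resp. ${\mathcal A}^\infty$) be the set of covectors with positive (resp. zero) $g$-component. A set $B=\{\lambda_1,\ldots,\lambda_{r-1}\}\subseteq E-\{f,g\}$ with $B\cup\{g\}$ independent is an affine basis; $v(B)$ denotes the unique vertex (cocircuit) $X$ with $X_B=0$ and $X_g=+$. $B_1\to B_2$ is a pivot operation if $B_1,B_2$ are affine bases and $L=B_2-\{b\}=B_1-\{a\}$ with $a,b\in E-\{f,g\}$, $a\ne b$; $L$ is its edge. For a pivot $L\cup\{a\}=B_1\to B_2=L\cup\{b\}$ with $L\cup\{a,b\}$ independent, its direction $d(B_1\to B_2)$ is the unique vertex $d\in{\mathcal A}^\infty$ with $d_L=0$ and $d_a=v(B_2)_a$. The pivot is degenerate if $v(B_1)=v(B_2)$; horizontal if $L\cup\{f,g\}$ is dependent; strictly increasing if $d(B_1\to B_2)_f>0$ and it is not degenerate. -}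

module Defs where

open import Data.Nat using (ℕ; zero; suc)
open import Data.Fin using (Fin; _≟_)
open import Data.Vec using (Vec; lookup; tabulate; _∷ʳ_; _[_]≔_)
open import Data.Product using (Σ; ∃; ∃-syntax; _×_)
open import Relation.Binary.PropositionalEquality using (_≡_; _≢_)
open import Relation.Nullary using (¬_; yes; no)

data Sign : Set where
  ⊖ ⊙ ⊕ : Sign

-ˢ_ : Sign → Sign
-ˢ ⊖ = ⊕
-ˢ ⊙ = ⊙
-ˢ ⊕ = ⊖

infixl 7 _·_
_·_ : Sign → Sign → Sign
⊙ · _ = ⊙
⊕ · s = s
⊖ · s = -ˢ s

-- A chirotope of rank (suc r) on the ground set Fin m is a
-- map χ from ordered (suc r)-tuples to signs, not identically zero,
-- alternating, and satisfying the Grassmann–Plücker relations (B2) of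
-- Björner–Las Vergnas–Sturmfels–White–Ziegler, Def. 3.5.3.

swapIdx : ∀ {n} → Fin n → Fin n → Fin n → Fin n
swapIdx i j p with p ≟ i
... | yes _ = j
... | no _ with p ≟ j
...   | yes _ = i
...   | no _ = p

swapEntries : ∀ {A : Set} {n} → Fin n → Fin n → Vec A n → Vec A n
swapEntries i j x = tabulate (λ p → lookup x (swapIdx i j p))

record IsChirotope (m r : ℕ) (χ : Vec (Fin m) (suc r) → Sign) : Set where
  field
    nontrivial  : ∃[ x ] χ x ≢ ⊙
    alternating : ∀ x (i j : Fin (suc r)) → i ≢ j →
                  χ (swapEntries i j x) ≡ -ˢ χ x
    repeated    : ∀ x (i j : Fin (suc r)) → i ≢ j →
                  lookup x i ≡ lookup x j → χ x ≡ ⊙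
    grassmannPlücker : ∀ (x y : Vec (Fin m) (suc r)) →
      (∀ (i : Fin (suc r)) →
         χ (x [ Fin.zero ]≔ lookup y i) · χ (y [ i ]≔ lookup x Fin.zero) ≢ ⊖) →
      χ x · χ y ≢ ⊖

-- Oriented matroid programs of rank r = suc (suc k) on ground set Fin m,
-- with distinguished elements f ≠ g.

record OMP (m k : ℕ) : Set where
  field
    χ     : Vec (Fin m) (suc (suc k)) → Sign
    isChi : IsChirotope m (suc k) χ
    f g   : Fin m
    f≢g   : f ≢ g

module _ {m k : ℕ} (P : OMP m k) where
  open OMP P

  Cocircuit : (Fin m → Sign) → Set
  Cocircuit X = Σ (Vec (Fin m) (suc k)) λ μ → Σ Sign λ s →
    (s ≢ ⊙) × (∃[ e ] χ (μ ∷ʳ e) ≢ ⊙) × (∀ e → X e ≡ s · χ (μ ∷ʳ e))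

  AffineBasis : Vec (Fin m) (suc k) → Set
  AffineBasis B = (∀ i → (lookup B i ≢ f) × (lookup B i ≢ g)) × (χ (B ∷ʳ g) ≢ ⊙)

  -- X is the vertex v(B): a vertex of 𝒜 (cocircuit with X_g = +) with X_B = 0
  IsVertexOf : Vec (Fin m) (suc k) → (Fin m → Sign) → Set
  IsVertexOf B X = Cocircuit X × (∀ i → X (lookup B i) ≡ ⊙) × (X g ≡ ⊕)

  Pivot : Vec (Fin m) k → Fin m → Fin m → Set
  Pivot L a b = (a ≢ b) × AffineBasis (L ∷ʳ a) × AffineBasis (L ∷ʳ b)

  -- d is the direction d(B₁ → B₂): a vertex of 𝒜^∞ (cocircuit with d_g = 0)
  -- with d_L = 0 and d_a = v(B₂)_a
  IsDirection : Vec (Fin m) k → Fin m → Fin m → (Fin m → Sign) → Set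
  IsDirection L a b d = Cocircuit d × (d g ≡ ⊙) × (∀ i → d (lookup L i) ≡ ⊙) ×
    (Σ (Fin m → Sign) λ X₂ → IsVertexOf (L ∷ʳ b) X₂ × (d a ≡ X₂ a))

  Degenerate : Vec (Fin m) k → Fin m → Fin m → Set
  Degenerate L a b = Σ (Fin m → Sign) λ X → IsVertexOf (L ∷ʳ a) X × IsVertexOf (L ∷ʳ b) X

  Horizontal : Vec (Fin m) k → Set
  Horizontal L = χ (L ∷ʳ f ∷ʳ g) ≡ ⊙

  -- L ∪ {a,b} independent (so the direction is defined), d_f > 0, not degenerate
  StrictlyIncreasing : Vec (Fin m) k → Fin m → Fin m → Set
  StrictlyIncreasing L a b = (χ (L ∷ʳ a ∷ʳ b) ≢ ⊙) ×
    (Σ (Fin m → Sign) λ d → IsDirection L a b d × (d f ≡ ⊕)) ×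
    ¬ Degenerate L a b

  pivotSign : Vec (Fin m) k → Fin m → Fin m → Sign
  pivotSign L a b = χ (L ∷ʳ g ∷ʳ f) · χ (L ∷ʳ a ∷ʳ b) · χ (L ∷ʳ g ∷ʳ a) · χ (L ∷ʳ g ∷ʳ b)

{-# OPTIONS --safe #-}
-- A cocircuit is determined up to sign by its zero set: by two Grassmann–Plücker
-- relations, each collapsing to a single term, a cocircuit X vanishing on L ∪ {z} satisfies
-- χ(L,z,w) = X_w · χ(L,z,e) for every e with X_e = +. Applied to the direction d (zero on L ∪ {g},
-- d_f = +) and to v(B₂) (zero on L ∪ {b}, positive at g), and using d_a = v(B₂)_a =: u, this gives
-- χ(L,g,a) = u·χ(L,g,f) and χ(L,a,b) = u·χ(L,g,b), so the pivot sign is a product of squares of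
-- nonzero signs. If v(B₁) = v(B₂), the same normal form gives χ(L,a,b) = v(B₂)_b · χ(L,a,g) = 0;
-- if the pivot is horizontal, χ(L,g,f) = 0.
module Submission where

open import Defs
open import Data.Nat using (ℕ; suc)
open import Data.Fin using (Fin; fromℕ; inject₁; _≟_)
open import Data.Fin.Properties using (fromℕ≢inject₁)
open import Data.Fin.Relation.Unary.Top using (view; ‵fromℕ; ‵inject₁)
open import Data.Vec using (Vec; []; _∷_; lookup; _∷ʳ_; _[_]≔_)
open import Data.Vec.Properties using (lookup∘update; lookup∘update′; tabulate-cong; tabulate∘lookup)
open import Data.Product using (_×_; _,_; proj₁; proj₂)
open import Data.Sum using (_⊎_; inj₁; inj₂)
open import Data.Empty using (⊥-elim)
open import Relation.Nullary using (yes; no)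
open import Relation.Binary.PropositionalEquality

-ˢ-involutive : ∀ x → -ˢ (-ˢ x) ≡ x
-ˢ-involutive ⊖ = refl
-ˢ-involutive ⊙ = refl
-ˢ-involutive ⊕ = refl

-ˢ-injective : ∀ {x y} → -ˢ x ≡ -ˢ y → x ≡ y
-ˢ-injective {x} {y} eq =
  trans (sym (-ˢ-involutive x)) (trans (cong -ˢ_ eq) (-ˢ-involutive y))

-ˢ-nonzero : ∀ {x} → x ≢ ⊙ → -ˢ x ≢ ⊙
-ˢ-nonzero {⊖} _ ()
-ˢ-nonzero {⊙} x≢⊙ _ = x≢⊙ refl
-ˢ-nonzero {⊕} _ ()

-ˢ-distribˡ-· : ∀ x y → -ˢ (x · y) ≡ (-ˢ x) · y
-ˢ-distribˡ-· ⊖ y = -ˢ-involutive y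
-ˢ-distribˡ-· ⊙ y = refl
-ˢ-distribˡ-· ⊕ y = refl

-ˢ-distribʳ-· : ∀ x y → -ˢ (x · y) ≡ x · (-ˢ y)
-ˢ-distribʳ-· ⊖ y = refl
-ˢ-distribʳ-· ⊙ y = refl
-ˢ-distribʳ-· ⊕ y = refl

·-identityʳ : ∀ x → x · ⊕ ≡ x
·-identityʳ ⊖ = refl
·-identityʳ ⊙ = refl
·-identityʳ ⊕ = refl

·-zeroʳ : ∀ x → x · ⊙ ≡ ⊙
·-zeroʳ ⊖ = refl
·-zeroʳ ⊙ = refl
·-zeroʳ ⊕ = refl

·-assoc : ∀ x y z → x · y · z ≡ x · (y · z)
·-assoc ⊖ y z = sym (-ˢ-distribˡ-· y z)
·-assoc ⊙ y z = refl
·-assoc ⊕ y z = refl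

·-nonzeroˡ : ∀ {x y} → x · y ≢ ⊙ → x ≢ ⊙
·-nonzeroˡ xy≢⊙ refl = xy≢⊙ refl

·-nonzeroʳ : ∀ {x y} → x · y ≢ ⊙ → y ≢ ⊙
·-nonzeroʳ {x} xy≢⊙ refl = xy≢⊙ (·-zeroʳ x)

·-selfInverse : ∀ {x} → x ≢ ⊙ → ∀ y → x · (x · y) ≡ y
·-selfInverse {⊖} _ y = -ˢ-involutive y
·-selfInverse {⊙} x≢⊙ _ = ⊥-elim (x≢⊙ refl)
·-selfInverse {⊕} _ y = refl

·-cancelˡ-zero : ∀ {x y} → x ≢ ⊙ → x · y ≡ ⊙ → y ≡ ⊙
·-cancelˡ-zero {x} {y} x≢⊙ xy≡⊙ = begin
  y            ≡⟨ sym (·-selfInverse x≢⊙ y) ⟩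
  x · (x · y)  ≡⟨ cong (x ·_) xy≡⊙ ⟩
  x · ⊙        ≡⟨ ·-zeroʳ x ⟩
  ⊙            ∎
  where open ≡-Reasoning

·≡⊕⇒≡ : ∀ {x y} → x · y ≡ ⊕ → y ≡ x
·≡⊕⇒≡ {x} {y} xy≡⊕ = begin
  y            ≡⟨ sym (·-selfInverse x≢⊙ y) ⟩
  x · (x · y)  ≡⟨ cong (x ·_) xy≡⊕ ⟩
  x · ⊕        ≡⟨ ·-identityʳ x ⟩
  x            ∎
  where
  open ≡-Reasoning
  x≢⊙ : x ≢ ⊙
  x≢⊙ = ·-nonzeroˡ (λ xy≡⊙ → ⊕≢⊙ (trans (sym xy≡⊕) xy≡⊙))
    where ⊕≢⊙ : ⊕ ≢ ⊙
          ⊕≢⊙ ()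

≡-by-sign : ∀ u v → (u ≢ ⊖ → v ≢ ⊖) → (v ≢ ⊖ → u ≢ ⊖) →
            (-ˢ u ≢ ⊖ → -ˢ v ≢ ⊖) → (-ˢ v ≢ ⊖ → -ˢ u ≢ ⊖) → u ≡ v
≡-by-sign ⊖ ⊖ _ _ _ _ = refl
≡-by-sign ⊙ ⊙ _ _ _ _ = refl
≡-by-sign ⊕ ⊕ _ _ _ _ = refl
≡-by-sign ⊖ ⊙ _ v⇒u _ _ = ⊥-elim (v⇒u (λ ()) refl)
≡-by-sign ⊖ ⊕ _ v⇒u _ _ = ⊥-elim (v⇒u (λ ()) refl)
≡-by-sign ⊙ ⊖ u⇒v _ _ _ = ⊥-elim (u⇒v (λ ()) refl)
≡-by-sign ⊙ ⊕ _ _ -u⇒-v _ = ⊥-elim (-u⇒-v (λ ()) refl)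
≡-by-sign ⊕ ⊖ u⇒v _ _ _ = ⊥-elim (u⇒v (λ ()) refl)
≡-by-sign ⊕ ⊙ _ _ _ -v⇒-u = ⊥-elim (-v⇒-u (λ ()) refl)

·-pairedSquares≡⊕ : ∀ {u x y} → u ≢ ⊙ → x ≢ ⊙ → y ≢ ⊙ → x · (u · y) · (u · x) · y ≡ ⊕
·-pairedSquares≡⊕ {⊙} u≢⊙ _ _ = ⊥-elim (u≢⊙ refl)
·-pairedSquares≡⊕ {x = ⊙} _ x≢⊙ _ = ⊥-elim (x≢⊙ refl)
·-pairedSquares≡⊕ {y = ⊙} _ _ y≢⊙ = ⊥-elim (y≢⊙ refl)
·-pairedSquares≡⊕ {⊖} {⊖} {⊖} _ _ _ = refl
·-pairedSquares≡⊕ {⊖} {⊖} {⊕} _ _ _ = refl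
·-pairedSquares≡⊕ {⊖} {⊕} {⊖} _ _ _ = refl
·-pairedSquares≡⊕ {⊖} {⊕} {⊕} _ _ _ = refl
·-pairedSquares≡⊕ {⊕} {⊖} {⊖} _ _ _ = refl
·-pairedSquares≡⊕ {⊕} {⊖} {⊕} _ _ _ = refl
·-pairedSquares≡⊕ {⊕} {⊕} {⊖} _ _ _ = refl
·-pairedSquares≡⊕ {⊕} {⊕} {⊕} _ _ _ = refl

module _ {A : Set} where

  lookup-∷ʳ-last : ∀ {n} (xs : Vec A n) x → lookup (xs ∷ʳ x) (fromℕ n) ≡ x
  lookup-∷ʳ-last []       x = refl
  lookup-∷ʳ-last (_ ∷ xs) x = lookup-∷ʳ-last xs x

  lookup-∷ʳ-inject₁ : ∀ {n} (xs : Vec A n) x i → lookup (xs ∷ʳ x) (inject₁ i) ≡ lookup xs i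
  lookup-∷ʳ-inject₁ (_ ∷ xs) x Fin.zero    = refl
  lookup-∷ʳ-inject₁ (_ ∷ xs) x (Fin.suc i) = lookup-∷ʳ-inject₁ xs x i

  []≔-∷ʳ-last : ∀ {n} (xs : Vec A n) x y → (xs ∷ʳ x) [ fromℕ n ]≔ y ≡ xs ∷ʳ y
  []≔-∷ʳ-last []       x y = refl
  []≔-∷ʳ-last (z ∷ xs) x y = cong (z ∷_) ([]≔-∷ʳ-last xs x y)

  []≔-∷ʳ-inject₁ : ∀ {n} (xs : Vec A n) x y i →
                   (xs ∷ʳ x) [ inject₁ i ]≔ y ≡ (xs [ i ]≔ y) ∷ʳ x
  []≔-∷ʳ-inject₁ (z ∷ xs) x y Fin.zero    = refl
  []≔-∷ʳ-inject₁ (z ∷ xs) x y (Fin.suc i) = cong (z ∷_) ([]≔-∷ʳ-inject₁ xs x y i)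

  swapEntries-≡-[]≔ : ∀ {n} (i j : Fin n) (v : Vec A n) →
                      swapEntries i j v ≡ v [ i ]≔ lookup v j [ j ]≔ lookup v i
  swapEntries-≡-[]≔ i j v = trans (tabulate-cong entry) (tabulate∘lookup _)
    where
    entry : ∀ p → lookup v (swapIdx i j p) ≡ lookup (v [ i ]≔ lookup v j [ j ]≔ lookup v i) p
    entry p with p ≟ i
    ... | yes refl with p ≟ j
    ...   | yes refl = sym (lookup∘update p (v [ p ]≔ lookup v p) (lookup v p))
    ...   | no p≢j   = sym (trans (lookup∘update′ p≢j (v [ p ]≔ lookup v j) (lookup v p))
                                  (lookup∘update p v (lookup v j)))
    entry p | no p≢i with p ≟ j
    ...   | yes refl = sym (lookup∘update p (v [ i ]≔ lookup v p) (lookup v i))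
    ...   | no p≢j   = sym (trans (lookup∘update′ p≢j (v [ i ]≔ lookup v j) (lookup v i))
                                  (lookup∘update′ p≢i v (lookup v j)))

  swapEntries-head-last : ∀ {n} x (xs : Vec A n) y →
                          swapEntries Fin.zero (fromℕ (suc n)) (x ∷ (xs ∷ʳ y)) ≡ y ∷ (xs ∷ʳ x)
  swapEntries-head-last {n} x xs y = begin
    swapEntries Fin.zero (fromℕ (suc n)) (x ∷ (xs ∷ʳ y))
      ≡⟨ swapEntries-≡-[]≔ Fin.zero (fromℕ (suc n)) (x ∷ (xs ∷ʳ y)) ⟩
    lookup (xs ∷ʳ y) (fromℕ n) ∷ ((xs ∷ʳ y) [ fromℕ n ]≔ x)
      ≡⟨ cong₂ _∷_ (lookup-∷ʳ-last xs y) ([]≔-∷ʳ-last xs y x) ⟩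
    y ∷ (xs ∷ʳ x) ∎
    where open ≡-Reasoning

  swapEntries-last-two : ∀ {n} (xs : Vec A n) x y →
    swapEntries (inject₁ (fromℕ n)) (fromℕ (suc n)) (xs ∷ʳ x ∷ʳ y) ≡ xs ∷ʳ y ∷ʳ x
  swapEntries-last-two {n} xs x y = begin
    swapEntries (inject₁ (fromℕ n)) (fromℕ (suc n)) v
      ≡⟨ swapEntries-≡-[]≔ (inject₁ (fromℕ n)) (fromℕ (suc n)) v ⟩
    v [ inject₁ (fromℕ n) ]≔ lookup v (fromℕ (suc n)) [ fromℕ (suc n) ]≔ lookup v (inject₁ (fromℕ n))
      ≡⟨ cong₂ (λ p q → v [ inject₁ (fromℕ n) ]≔ p [ fromℕ (suc n) ]≔ q)
               (lookup-∷ʳ-last (xs ∷ʳ x) y)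
               (trans (lookup-∷ʳ-inject₁ (xs ∷ʳ x) y (fromℕ n)) (lookup-∷ʳ-last xs x)) ⟩
    v [ inject₁ (fromℕ n) ]≔ y [ fromℕ (suc n) ]≔ x
      ≡⟨ cong (_[ fromℕ (suc n) ]≔ x)
              (trans ([]≔-∷ʳ-inject₁ (xs ∷ʳ x) y y (fromℕ n))
                     (cong (_∷ʳ y) ([]≔-∷ʳ-last xs x y))) ⟩
    (xs ∷ʳ y ∷ʳ y) [ fromℕ (suc n) ]≔ x
      ≡⟨ []≔-∷ʳ-last (xs ∷ʳ y) y x ⟩
    xs ∷ʳ y ∷ʳ x ∎
    where
    open ≡-Reasoning
    v : Vec A (suc (suc n))
    v = xs ∷ʳ x ∷ʳ y

  VanishesOn : ∀ {n} → (A → Sign) → Vec A n → Set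
  VanishesOn X v = ∀ i → X (lookup v i) ≡ ⊙

  vanishesOn-∷ʳ : ∀ {n X} (xs : Vec A n) x → VanishesOn X xs → X x ≡ ⊙ → VanishesOn X (xs ∷ʳ x)
  vanishesOn-∷ʳ {X = X} xs x vanish Xx≡⊙ i with view i
  ... | ‵fromℕ     = trans (cong X (lookup-∷ʳ-last xs x)) Xx≡⊙
  ... | ‵inject₁ j = trans (cong X (lookup-∷ʳ-inject₁ xs x j)) (vanish j)

  vanishesOn-∷ʳ⁻ : ∀ {n X} (xs : Vec A n) x → VanishesOn X (xs ∷ʳ x) → VanishesOn X xs × X x ≡ ⊙
  vanishesOn-∷ʳ⁻ {n} {X} xs x vanish =
    (λ j → trans (cong X (sym (lookup-∷ʳ-inject₁ xs x j))) (vanish (inject₁ j))) ,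
    trans (cong X (sym (lookup-∷ʳ-last xs x))) (vanish (fromℕ n))

  vanishesOn-∷ʳ-init : ∀ {n X} (xs : Vec A n) → VanishesOn X xs →
                       ∀ x i → i ≢ fromℕ n → X (lookup (xs ∷ʳ x) i) ≡ ⊙
  vanishesOn-∷ʳ-init {X = X} xs vanish x i i≢last with view i
  ... | ‵fromℕ     = ⊥-elim (i≢last refl)
  ... | ‵inject₁ j = trans (cong X (lookup-∷ʳ-inject₁ xs x j)) (vanish j)

  vanishesOn-∷ʳ-∷ʳ-skip : ∀ {n X} (xs : Vec A n) z → VanishesOn X (xs ∷ʳ z) →
                          ∀ w i → i ≢ inject₁ (fromℕ n) → X (lookup (xs ∷ʳ w ∷ʳ z) i) ≡ ⊙
  vanishesOn-∷ʳ-∷ʳ-skip {X = X} xs z vanish w i i≢penultimate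
    with vanishesOn-∷ʳ⁻ {X = X} xs z vanish | view i
  ... | _ , Xz≡⊙      | ‵fromℕ     = trans (cong X (lookup-∷ʳ-last (xs ∷ʳ w) z)) Xz≡⊙
  ... | vanish-xs , _ | ‵inject₁ j = trans (cong X (lookup-∷ʳ-inject₁ (xs ∷ʳ w) z j))
    (vanishesOn-∷ʳ-init {X = X} xs vanish-xs w j (λ j≡last → i≢penultimate (cong inject₁ j≡last)))

module ChirotopeProperties {m k : ℕ} {χ : Vec (Fin m) (suc (suc k)) → Sign}
                           (isChi : IsChirotope m (suc k) χ) where
  open IsChirotope isChi

  last penultimate : Fin (suc (suc k))
  last        = fromℕ (suc k)
  penultimate = inject₁ (fromℕ k)

  χ-swap-last-two : ∀ (H : Vec (Fin m) k) x y → χ (H ∷ʳ x ∷ʳ y) ≡ -ˢ χ (H ∷ʳ y ∷ʳ x)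
  χ-swap-last-two H x y = begin
    χ (H ∷ʳ x ∷ʳ y)                                 ≡⟨ cong χ (sym (swapEntries-last-two H y x)) ⟩
    χ (swapEntries penultimate last (H ∷ʳ y ∷ʳ x))  ≡⟨ alternating _ penultimate last penultimate≢last ⟩
    -ˢ χ (H ∷ʳ y ∷ʳ x)                              ∎
    where
    open ≡-Reasoning
    penultimate≢last : penultimate ≢ last
    penultimate≢last eq = fromℕ≢inject₁ (sym eq)

  χ-swap-head-last : ∀ x (xs : Vec (Fin m) k) y → χ (y ∷ (xs ∷ʳ x)) ≡ -ˢ χ (x ∷ (xs ∷ʳ y))
  χ-swap-head-last x xs y = begin
    χ (y ∷ (xs ∷ʳ x))                                 ≡⟨ cong χ (sym (swapEntries-head-last x xs y)) ⟩
    χ (swapEntries Fin.zero last (x ∷ (xs ∷ʳ y)))     ≡⟨ alternating _ Fin.zero last (λ ()) ⟩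
    -ˢ χ (x ∷ (xs ∷ʳ y))                              ∎
    where open ≡-Reasoning

  grassmannPlücker-single : ∀ x y i₀ →
    (∀ i → i ≢ i₀ → χ (x [ Fin.zero ]≔ lookup y i) ≡ ⊙) →
    χ (x [ Fin.zero ]≔ lookup y i₀) · χ (y [ i₀ ]≔ lookup x Fin.zero) ≢ ⊖ →
    χ x · χ y ≢ ⊖
  grassmannPlücker-single x y i₀ others≡⊙ term₀≢⊖ = grassmannPlücker x y term≢⊖
    where
    term≢⊖ : ∀ i → χ (x [ Fin.zero ]≔ lookup y i) · χ (y [ i ]≔ lookup x Fin.zero) ≢ ⊖
    term≢⊖ i with i ≟ i₀
    ... | yes refl = term₀≢⊖
    ... | no i≢i₀ rewrite others≡⊙ i i≢i₀ = λ ()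

  -- Two Grassmann–Plücker relations, with y = (H,z,w) and y = (H,w,z), each reduced to a single term.
  χ-head-proportional : ∀ (ρ : Vec (Fin m) (suc k)) (H : Vec (Fin m) k) z →
    VanishesOn (λ q → χ (q ∷ ρ)) (H ∷ʳ z) →
    ∀ e w → χ (w ∷ ρ) · χ (H ∷ʳ z ∷ʳ e) ≡ χ (e ∷ ρ) · χ (H ∷ʳ z ∷ʳ w)
  χ-head-proportional ρ H z vanish e w =
    ≡-by-sign _ _ (nonneg e w) (nonneg w e) (nonpos e w) (nonpos w e)
    where
    A C : Fin m → Sign
    A q = χ (q ∷ ρ)
    C q = χ (H ∷ʳ z ∷ʳ q)

    nonneg : ∀ e w → A w · C e ≢ ⊖ → A e · C w ≢ ⊖
    nonneg e w AwCe≢⊖ =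
      grassmannPlücker-single (e ∷ ρ) (H ∷ʳ z ∷ʳ w) last (vanishesOn-∷ʳ-init {X = A} (H ∷ʳ z) vanish w)
        (subst (_≢ ⊖) (sym term≡) AwCe≢⊖)
      where
      term≡ : A (lookup (H ∷ʳ z ∷ʳ w) last) · χ ((H ∷ʳ z ∷ʳ w) [ last ]≔ e) ≡ A w · C e
      term≡ = cong₂ (λ p v → A p · χ v) (lookup-∷ʳ-last (H ∷ʳ z) w) ([]≔-∷ʳ-last (H ∷ʳ z) w e)

    nonpos : ∀ e w → -ˢ (A w · C e) ≢ ⊖ → -ˢ (A e · C w) ≢ ⊖
    nonpos e w -AwCe≢⊖ =
      subst (_≢ ⊖) concl≡
        (grassmannPlücker-single (e ∷ ρ) (H ∷ʳ w ∷ʳ z) penultimate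
          (vanishesOn-∷ʳ-∷ʳ-skip {X = A} H z vanish w)
          (subst (_≢ ⊖) (sym term≡) -AwCe≢⊖))
      where
      open ≡-Reasoning
      term≡ : A (lookup (H ∷ʳ w ∷ʳ z) penultimate) · χ ((H ∷ʳ w ∷ʳ z) [ penultimate ]≔ e)
              ≡ -ˢ (A w · C e)
      term≡ = begin
        A (lookup (H ∷ʳ w ∷ʳ z) penultimate) · χ ((H ∷ʳ w ∷ʳ z) [ penultimate ]≔ e)
          ≡⟨ cong₂ (λ p v → A p · χ v)
                   (trans (lookup-∷ʳ-inject₁ (H ∷ʳ w) z (fromℕ k)) (lookup-∷ʳ-last H w))
                   (trans ([]≔-∷ʳ-inject₁ (H ∷ʳ w) z e (fromℕ k)) (cong (_∷ʳ z) ([]≔-∷ʳ-last H w e))) ⟩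
        A w · χ (H ∷ʳ e ∷ʳ z)   ≡⟨ cong (A w ·_) (χ-swap-last-two H e z) ⟩
        A w · -ˢ C e            ≡⟨ sym (-ˢ-distribʳ-· (A w) (C e)) ⟩
        -ˢ (A w · C e)          ∎
      concl≡ : A e · χ (H ∷ʳ w ∷ʳ z) ≡ -ˢ (A e · C w)
      concl≡ = trans (cong (A e ·_) (χ-swap-last-two H w z)) (sym (-ˢ-distribʳ-· (A e) (C w)))

  χ-last-proportional : ∀ (μ : Vec (Fin m) (suc k)) (H : Vec (Fin m) k) z →
    VanishesOn (λ q → χ (μ ∷ʳ q)) (H ∷ʳ z) →
    ∀ e w → χ (μ ∷ʳ w) · χ (H ∷ʳ z ∷ʳ e) ≡ χ (μ ∷ʳ e) · χ (H ∷ʳ z ∷ʳ w)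
  χ-last-proportional (μ₀ ∷ μ) H z vanish e w = -ˢ-injective (begin
    -ˢ (A w · C e)          ≡⟨ -ˢ-distribˡ-· (A w) (C e) ⟩
    -ˢ A w · C e            ≡⟨ cong (_· C e) (sym (rotate w)) ⟩
    χ (w ∷ ρ) · C e         ≡⟨ χ-head-proportional ρ H z vanishʳ e w ⟩
    χ (e ∷ ρ) · C w         ≡⟨ cong (_· C w) (rotate e) ⟩
    -ˢ A e · C w            ≡⟨ sym (-ˢ-distribˡ-· (A e) (C w)) ⟩
    -ˢ (A e · C w)          ∎)
    where
    open ≡-Reasoning
    A C : Fin m → Sign
    A q = χ ((μ₀ ∷ μ) ∷ʳ q)
    C q = χ (H ∷ʳ z ∷ʳ q)
    ρ : Vec (Fin m) (suc k)
    ρ = μ ∷ʳ μ₀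
    rotate : ∀ q → χ (q ∷ ρ) ≡ -ˢ A q
    rotate q = χ-swap-head-last μ₀ μ q
    vanishʳ : VanishesOn (λ q → χ (q ∷ ρ)) (H ∷ʳ z)
    vanishʳ i = trans (rotate _) (cong -ˢ_ (vanish i))

module _ {m k : ℕ} (P : OMP m k) where
  open OMP P
  open ChirotopeProperties isChi

  cocircuit-normalForm : ∀ {X} → Cocircuit P X → ∀ (H : Vec (Fin m) k) z → VanishesOn X (H ∷ʳ z) →
                         ∀ {e₀} → X e₀ ≡ ⊕ → ∀ w → χ (H ∷ʳ z ∷ʳ w) ≡ X w · χ (H ∷ʳ z ∷ʳ e₀)
  cocircuit-normalForm {X} (μ , s , s≢⊙ , _ , X≡) H z vanish {e₀} Xe₀≡⊕ w = begin
    C w               ≡⟨ sym (·-selfInverse s≢⊙ (C w)) ⟩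
    s · (s · C w)     ≡⟨ cong (λ t → s · (t · C w)) (sym Ae₀≡s) ⟩
    s · (A e₀ · C w)  ≡⟨ cong (s ·_) (χ-last-proportional μ H z vanishA w e₀) ⟩
    s · (A w · C e₀)  ≡⟨ sym (·-assoc s (A w) (C e₀)) ⟩
    s · A w · C e₀    ≡⟨ cong (_· C e₀) (sym (X≡ w)) ⟩
    X w · C e₀        ∎
    where
    open ≡-Reasoning
    A C : Fin m → Sign
    A q = χ (μ ∷ʳ q)
    C q = χ (H ∷ʳ z ∷ʳ q)
    Ae₀≡s : A e₀ ≡ s
    Ae₀≡s = ·≡⊕⇒≡ (trans (sym (X≡ e₀)) Xe₀≡⊕)
    vanishA : VanishesOn A (H ∷ʳ z)
    vanishA i = ·-cancelˡ-zero s≢⊙ (trans (sym (X≡ _)) (vanish i))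

  pivotSign-increasing : ∀ L a b {d} → χ (L ∷ʳ a ∷ʳ g) ≢ ⊙ → χ (L ∷ʳ b ∷ʳ g) ≢ ⊙ →
                         IsDirection P L a b d → d f ≡ ⊕ → pivotSign P L a b ≡ ⊕
  pivotSign-increasing L a b {d} χLag≢⊙ χLbg≢⊙
    (d-cocircuit , dg≡⊙ , dL≡⊙ , X₂ , (X₂-cocircuit , X₂-vanish , X₂g≡⊕) , da≡X₂a) df≡⊕ = begin
    Cg f · χ (L ∷ʳ a ∷ʳ b) · Cg a · Cg b   ≡⟨ cong₂ (λ p q → Cg f · p · q · Cg b) χLab≡ Cga≡ ⟩
    Cg f · (u · Cg b) · (u · Cg f) · Cg b  ≡⟨ ·-pairedSquares≡⊕ u≢⊙ Cgf≢⊙ Cgb≢⊙ ⟩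
    ⊕                                      ∎
    where
    open ≡-Reasoning
    Cg : Fin m → Sign
    Cg q = χ (L ∷ʳ g ∷ʳ q)
    u : Sign
    u = d a

    Cga≡ : Cg a ≡ u · Cg f
    Cga≡ = cocircuit-normalForm d-cocircuit L g (vanishesOn-∷ʳ L g dL≡⊙ dg≡⊙) df≡⊕ a

    χLab≡ : χ (L ∷ʳ a ∷ʳ b) ≡ u · Cg b
    χLab≡ = begin
      χ (L ∷ʳ a ∷ʳ b)           ≡⟨ χ-swap-last-two L a b ⟩
      -ˢ χ (L ∷ʳ b ∷ʳ a)        ≡⟨ cong -ˢ_ (cocircuit-normalForm X₂-cocircuit L b X₂-vanish X₂g≡⊕ a) ⟩
      -ˢ (X₂ a · χ (L ∷ʳ b ∷ʳ g)) ≡⟨ cong (λ t → -ˢ (t · χ (L ∷ʳ b ∷ʳ g))) (sym da≡X₂a) ⟩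
      -ˢ (u · χ (L ∷ʳ b ∷ʳ g))  ≡⟨ -ˢ-distribʳ-· u _ ⟩
      u · -ˢ χ (L ∷ʳ b ∷ʳ g)    ≡⟨ cong (u ·_) (sym (χ-swap-last-two L g b)) ⟩
      u · Cg b                  ∎

    Cga≢⊙ : Cg a ≢ ⊙
    Cga≢⊙ = subst (_≢ ⊙) (sym (χ-swap-last-two L g a)) (-ˢ-nonzero χLag≢⊙)
    Cgb≢⊙ : Cg b ≢ ⊙
    Cgb≢⊙ = subst (_≢ ⊙) (sym (χ-swap-last-two L g b)) (-ˢ-nonzero χLbg≢⊙)
    u≢⊙ : u ≢ ⊙
    u≢⊙ = ·-nonzeroˡ (subst (_≢ ⊙) Cga≡ Cga≢⊙)
    Cgf≢⊙ : Cg f ≢ ⊙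
    Cgf≢⊙ = ·-nonzeroʳ {u} (subst (_≢ ⊙) Cga≡ Cga≢⊙)

  pivotSign-degenerate : ∀ L a b → Degenerate P L a b → pivotSign P L a b ≡ ⊙
  pivotSign-degenerate L a b (X , (X-cocircuit , Xa-vanish , Xg≡⊕) , (_ , Xb-vanish , _)) = begin
    Cg f · χ (L ∷ʳ a ∷ʳ b) · Cg a · Cg b  ≡⟨ cong (λ p → Cg f · p · Cg a · Cg b) χLab≡⊙ ⟩
    Cg f · ⊙ · Cg a · Cg b                ≡⟨ cong (λ p → p · Cg a · Cg b) (·-zeroʳ (Cg f)) ⟩
    ⊙                                     ∎
    where
    open ≡-Reasoning
    Cg : Fin m → Sign
    Cg q = χ (L ∷ʳ g ∷ʳ q)
    χLab≡⊙ : χ (L ∷ʳ a ∷ʳ b) ≡ ⊙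
    χLab≡⊙ = trans (cocircuit-normalForm X-cocircuit L a Xa-vanish Xg≡⊕ b)
                   (cong (_· χ (L ∷ʳ a ∷ʳ g)) (proj₂ (vanishesOn-∷ʳ⁻ {X = X} L b Xb-vanish)))

  pivotSign-horizontal : ∀ L a b → Horizontal P L → pivotSign P L a b ≡ ⊙
  pivotSign-horizontal L a b χLfg≡⊙ =
    cong (λ p → p · χ (L ∷ʳ a ∷ʳ b) · χ (L ∷ʳ g ∷ʳ a) · χ (L ∷ʳ g ∷ʳ b))
         (trans (χ-swap-last-two L g f) (cong -ˢ_ χLfg≡⊙))

lemma2 : ∀ {m k : ℕ} (P : OMP m k) (L : Vec (Fin m) k) (a b : Fin m) →
    Pivot P L a b →
    (StrictlyIncreasing P L a b → pivotSign P L a b ≡ ⊕) ×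
    (Degenerate P L a b ⊎ Horizontal P L → pivotSign P L a b ≡ ⊙)
lemma2 P L a b (_ , (_ , χLag≢⊙) , (_ , χLbg≢⊙)) = increasing , degenerate-or-horizontal
  where
  -- Independence of L ∪ {a,b} and non-degeneracy are implied by the other hypotheses.
  increasing : StrictlyIncreasing P L a b → pivotSign P L a b ≡ ⊕
  increasing (_ , (_ , direction , df≡⊕) , _) =
    pivotSign-increasing P L a b χLag≢⊙ χLbg≢⊙ direction df≡⊕

  degenerate-or-horizontal : Degenerate P L a b ⊎ Horizontal P L → pivotSign P L a b ≡ ⊙
  degenerate-or-horizontal (inj₁ degenerate) = pivotSign-degenerate P L a b degenerate
  degenerate-or-horizontal (inj₂ horizontal) = pivotSign-horizontal P L a b horizontal
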